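{- For any model $\mathcal{M}$, world $w$ and information state $X$: $\mathcal{M},w,X\vDash \lambda$ iff $\mathcal{M},w,X\vDash \lambda^*$, where $\lambda=\Theta\Rightarrow\Omega$ is interpreted by the Kolodny--MacFarlane semantics.
   Context: Models $\mathcal{M}=\langle W,V\rangle$; evaluation at $w$ relative to $X\subseteq W$: $p$ and Booleans as usual, $\mathcal{M},w,X\vDash\Box\varphi$ iff $\mathcal{M},v,X\vDash\varphi$ for all $v\in X$, $\Diamond=\neg\Box\neg$; $[\![\varphi]\!]^{\mathcal{M},X}=\{v\in X\mid \mathcal{M},v,X\vDash\varphi\}$. Kolodny--MacFarlane: $\mathcal{M},w,X\vDash \varphi\Rightarrow\psi$ iff $\mathcal{M},w,X'\vDash \Box\psi$ for all $X'$ maximal (under $\subseteq$) among subsets of $X$ with $X'\subseteq[\![\varphi]\!]^{\mathcal{M},X'}$. Here $\lambda=\Theta\Rightarrow\Omega$ with $\Theta=\bigvee_{i\in I}\theta_i$, $\Omega=\bigvee_{j\in J}\omega_j$ in K45 disjunctive normal form: $\theta_i= \varphi_i\wedge \Box\psi_i \wedge \bigwedge_{n\in D_i} \Diamond\chi_n$, $\omega_j= \alpha_j\wedge \Box\beta_j \wedge \bigwedge_{m\in D_j} \Diamond\gamma_m$, all of $\varphi_i,\psi_i,\chi_n,\alpha_j,\beta_j,\gamma_m$ nonmodal. For $K\subseteq I$: $\mathtt{info}_K:= (\bigvee_{k\in K} \varphi_k )\wedge \bigwedge_{k\in K}\psi_k$; $\mathtt{good}_K:= \bigwedge_{k\in K}\bigwedge_{n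 \in D_k} \Diamond (\mathtt{info}_K \wedge\chi_n)$; $\mathtt{max}_K:= \mathtt{good}_K\wedge \bigwedge_{L\subseteq I}\big(\big(\Box(\mathtt{info}_K\rightarrow \mathtt{info}_L)\wedge \Diamond (\neg \mathtt{info}_K\wedge\mathtt{info}_L)\big)\rightarrow \neg\mathtt{good}_L \big)$; for $S\subseteq J$: $\mathtt{state}_S:= \bigwedge_{s\in S}\alpha_s\wedge \bigwedge_{s\in J\setminus S}\neg\alpha_s$; and $\lambda^*:= \bigwedge_{K\subseteq I} \Big(\mathtt{max}_K\rightarrow \Box \big(\mathtt{info}_K \rightarrow \bigwedge_{S\subseteq J} \big(\mathtt{state}_S\rightarrow \bigvee_{s\in S}\big(\Box (\mathtt{info}_K\rightarrow \beta_s)\wedge \bigwedge_{m \in D_s}\Diamond(\mathtt{info}_K \wedge \gamma_m) \big) \big)\big) \Big)$. -}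

module Defs where

open import Level using (Level; 0ℓ) renaming (suc to lsuc)
open import Data.Nat using (ℕ; zero; suc)
open import Data.Fin using (Fin; zero; suc)
open import Data.Fin.Subset using (Subset; inside; outside; ∁)
open import Data.Vec using (Vec; []; _∷_)
open import Data.List using (List; []; _∷_; map; foldr; _++_; tabulate)
open import Data.Product using (_×_)
open import Data.Sum using (_⊎_)
import Data.Empty as E

data Fm : Set where
  atom : ℕ → Fm
  ⊥′   : Fm
  ¬′_  : Fm → Fm
  _∧′_ : Fm → Fm → Fm
  _∨′_ : Fm → Fm → Fm
  _→′_ : Fm → Fm → Fm
  □_   : Fm → Fm

infixr 6 _∧′_
infixr 5 _∨′_
infixr 4 _→′_
infix 7 ¬′_ □_ ◇_

⊤′ : Fm
⊤′ = ¬′ ⊥′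

◇_ : Fm → Fm
◇ φ = ¬′ (□ (¬′ φ))

data NonModal : Fm → Set where
  nm-atom : ∀ p → NonModal (atom p)
  nm-⊥    : NonModal ⊥′
  nm-¬    : ∀ {φ} → NonModal φ → NonModal (¬′ φ)
  nm-∧    : ∀ {φ ψ} → NonModal φ → NonModal ψ → NonModal (φ ∧′ ψ)
  nm-∨    : ∀ {φ ψ} → NonModal φ → NonModal ψ → NonModal (φ ∨′ ψ)
  nm-→    : ∀ {φ ψ} → NonModal φ → NonModal ψ → NonModal (φ →′ ψ)

⋀ : List Fm → Fm
⋀ = foldr _∧′_ ⊤′

⋁ : List Fm → Fm
⋁ = foldr _∨′_ ⊥′

record Model : Set₁ where
  field
    W : Set
    V : ℕ → W → Set

open Model public

State : Model → Set₁
State M = W M → Set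

_⊆_ : ∀ {M : Model} → State M → State M → Set
_⊆_ {M} X Y = ∀ (v : W M) → X v → Y v

sat : (M : Model) → W M → State M → Fm → Set
sat M w X (atom p) = V M p w
sat M w X ⊥′ = E.⊥
sat M w X (¬′ φ) = sat M w X φ → E.⊥
sat M w X (φ ∧′ ψ) = sat M w X φ × sat M w X ψ
sat M w X (φ ∨′ ψ) = sat M w X φ ⊎ sat M w X ψ
sat M w X (φ →′ ψ) = sat M w X φ → sat M w X ψ
sat M w X (□ φ) = ∀ (v : W M) → X v → sat M v X φ

Supports : (M : Model) → State M → Fm → Set
Supports M X′ φ = ∀ (v : W M) → X′ v → sat M v X′ φ

MaximalFor : (M : Model) → State M → Fm → State M → Set₁
MaximalFor M X φ X′ =
  (_⊆_ {M} X′ X) × Supports M X′ φ ×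
  (∀ (Y : State M) → _⊆_ {M} Y X → Supports M Y φ → _⊆_ {M} X′ Y → _⊆_ {M} Y X′)

satKM : (M : Model) → W M → State M → Fm → Fm → Set₁
satKM M w X φ ψ = ∀ (X′ : State M) → MaximalFor M X φ X′ → sat M w X′ (□ ψ)

-- K45 disjunctive normal form pieces:  base ∧ □ box ∧ ⋀_{χ ∈ dias} ◇ χ

record Disj : Set where
  constructor disj
  field
    base : Fm
    box  : Fm
    dias : List Fm

open Disj public

DisjNonModal : Disj → Set
DisjNonModal d = NonModal (base d) × NonModal (box d) × (∀ χ → χ Data.List.Membership.Propositional.∈ dias d → NonModal χ)
  where import Data.List.Membership.Propositional

disjFm : Disj → Fm
disjFm d = base d ∧′ (□ box d) ∧′ ⋀ (map ◇_ (dias d))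

dnf : ∀ {n} → (Fin n → Disj) → Fm
dnf {n} θ = ⋁ (tabulate (λ i → disjFm (θ i)))

elems : ∀ {n} → Subset n → List (Fin n)
elems [] = []
elems (inside ∷ s) = zero ∷ map suc (elems s)
elems (outside ∷ s) = map suc (elems s)

allSubsets : ∀ n → List (Subset n)
allSubsets zero = [] ∷ []
allSubsets (suc n) = map (inside ∷_) (allSubsets n) ++ map (outside ∷_) (allSubsets n)

⋀∈ : ∀ {n} → Subset n → (Fin n → Fm) → Fm
⋀∈ K f = ⋀ (map f (elems K))

⋁∈ : ∀ {n} → Subset n → (Fin n → Fm) → Fm
⋁∈ K f = ⋁ (map f (elems K))

⋀⊆ : ∀ n → (Subset n → Fm) → Fm
⋀⊆ n f = ⋀ (map f (allSubsets n))

module Translation {nI nJ : ℕ} (θ : Fin nI → Disj) (ω : Fin nJ → Disj) where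

  info : Subset nI → Fm
  info K = ⋁∈ K (λ k → base (θ k)) ∧′ ⋀∈ K (λ k → box (θ k))

  good : Subset nI → Fm
  good K = ⋀∈ K (λ k → ⋀ (map (λ χ → ◇ (info K ∧′ χ)) (dias (θ k))))

  max : Subset nI → Fm
  max K = good K ∧′
    ⋀⊆ nI (λ L → ((□ (info K →′ info L)) ∧′ ◇ ((¬′ info K) ∧′ info L)) →′ ¬′ good L)

  state : Subset nJ → Fm
  state S = ⋀∈ S (λ s → base (ω s)) ∧′ ⋀∈ (∁ S) (λ s → ¬′ base (ω s))

  λ* : Fm
  λ* = ⋀⊆ nI (λ K →
         max K →′ □ (info K →′
           ⋀⊆ nJ (λ S → state S →′
             ⋁∈ S (λ s → (□ (info K →′ box (ω s))) ∧′
                          ⋀ (map (λ γ → ◇ (info K ∧′ γ)) (dias (ω s)))))))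

lamStar : ∀ {nI nJ} → (Fin nI → Disj) → (Fin nJ → Disj) → Fm
lamStar θ ω = Translation.λ* θ ω

module Submission where

open import Defs
open import Level using (0ℓ)
open import Data.Nat using (ℕ; zero; suc)
open import Data.Fin using (Fin; zero; suc)
open import Function.Base using (_∘_)
open import Function.Bundles using (_⇔_; mk⇔; Equivalence)
open import Axiom.ExcludedMiddle using (ExcludedMiddle)
open import Data.Fin.Subset using (Subset; inside; outside; ∁) renaming (_∈_ to _∈ₛ_)
open import Data.Fin.Subset.Properties using (_∈?_; x∈∁p⇒x∉p; x∉p⇒x∈∁p)
open import Data.Vec using ([]; _∷_; here; there)
open import Data.List using (List; []; _∷_; map)
open import Data.List.Membership.Propositional using (_∈_)
open import Data.List.Membership.Propositional.Properties using (∈-map⁺; ∈-map⁻; ∈-++⁺ˡ; ∈-++⁺ʳ)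
open import Data.List.Relation.Unary.Any using (here; there)
open import Data.Product using (Σ; _×_; _,_; proj₁; proj₂)
open import Data.Sum using (inj₁; inj₂)
open import Data.Empty using (⊥-elim)
open import Relation.Nullary using (Dec; yes; no; does; ¬_)
open import Relation.Binary.PropositionalEquality using (refl)

open Equivalence using (to; from)

-- For K ⊆ I write X[K] for the restriction of X to the worlds satisfying
-- info_K.  Two facts about restrictions drive everything:
--   * nonmodal formulas ignore the information state, so evaluating a
--     normal-form disjunct at X ∣ φ is the same as evaluating its
--     "φ-relativised" version (boxes and diamonds guarded by φ) at X;
--   * for Y ⊆ X supporting Θ, its profile K(Y) (the i whose modal part
--     holds at Y) satisfies good_{K(Y)} and Y ⊆ X[K(Y)].
-- From these, the maximal Θ-supporting subsets of X are exactly (up to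
-- extension) the states X[K] with max_K true, and □Ω at X[K] is the
-- consequent of λ* for K.

∈-elems : ∀ {n} {x : Fin n} (K : Subset n) → x ∈ elems K ⇔ x ∈ₛ K
∈-elems {x = x} K = mk⇔ (to-ₛ K) (from-ₛ K)
  where
  from-ₛ : ∀ {n} {x : Fin n} (K : Subset n) → x ∈ₛ K → x ∈ elems K
  from-ₛ (inside ∷ K) here = here refl
  from-ₛ (inside ∷ K) (there x∈K) = there (∈-map⁺ suc (from-ₛ K x∈K))
  from-ₛ (outside ∷ K) (there x∈K) = ∈-map⁺ suc (from-ₛ K x∈K)

  to-ₛ : ∀ {n} {x : Fin n} (K : Subset n) → x ∈ elems K → x ∈ₛ K
  to-ₛ {x = zero} (inside ∷ K) _ = here
  to-ₛ {x = suc x} (inside ∷ K) (there x∈) with ∈-map⁻ suc x∈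
  ... | y , y∈ , refl = there (to-ₛ K y∈)
  to-ₛ {x = zero} (outside ∷ K) x∈ with ∈-map⁻ suc x∈
  ... | _ , _ , ()
  to-ₛ {x = suc x} (outside ∷ K) x∈ with ∈-map⁻ suc x∈
  ... | y , y∈ , refl = there (to-ₛ K y∈)

∈-allSubsets : ∀ {n} (K : Subset n) → K ∈ allSubsets n
∈-allSubsets {zero} [] = here refl
∈-allSubsets {suc n} (inside ∷ K) = ∈-++⁺ˡ (∈-map⁺ (inside ∷_) (∈-allSubsets K))
∈-allSubsets {suc n} (outside ∷ K) =
  ∈-++⁺ʳ (map (inside ∷_) (allSubsets n)) (∈-map⁺ (outside ∷_) (∈-allSubsets K))

select : ∀ {n} {P : Fin n → Set} → (∀ i → Dec (P i)) → Subset n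
select {zero} P? = []
select {suc n} P? = does (P? zero) ∷ select (P? ∘ suc)

∈-select : ∀ {n} {P : Fin n → Set} (P? : ∀ i → Dec (P i)) i → i ∈ₛ select P? ⇔ P i
∈-select P? zero with P? zero
... | yes p = mk⇔ (λ _ → p) (λ _ → here)
... | no ¬p = mk⇔ (λ ()) (λ p → ⊥-elim (¬p p))
∈-select P? (suc i) =
  mk⇔ (λ { (there i∈) → to (∈-select (P? ∘ suc) i) i∈ })
      (λ p → there (from (∈-select (P? ∘ suc) i) p))

-- The modal part □ β ∧ ⋀ ◇ γ of a normal-form disjunct, so that
-- disjFm d is definitionally base d ∧′ modalPart d.
modalPart : Disj → Fm
modalPart d = (□ box d) ∧′ ⋀ (map ◇_ (dias d))

-- The modal part of d with every modality guarded by φ; at X it says what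
-- the modal part of d says at the restriction of X to φ.
relTo : Fm → Disj → Fm
relTo φ d = (□ (φ →′ box d)) ∧′ ⋀ (map (λ γ → ◇ (φ ∧′ γ)) (dias d))

stateFm : ∀ {n} → (Fin n → Fm) → Subset n → Fm
stateFm a S = ⋀∈ S a ∧′ ⋀∈ (∁ S) (λ s → ¬′ a s)

module Semantics (M : Model) where

  infix 4 _⊑_
  _⊑_ : State M → State M → Set
  _⊑_ = _⊆_ {M}

  ⊑-trans : ∀ {X Y Z : State M} → X ⊑ Y → Y ⊑ Z → X ⊑ Z
  ⊑-trans X⊑Y Y⊑Z v Xv = Y⊑Z v (X⊑Y v Xv)

  ⋀-sat : ∀ {A : Set} {w X} (f : A → Fm) (l : List A) →
    sat M w X (⋀ (map f l)) ⇔ (∀ x → x ∈ l → sat M w X (f x))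
  ⋀-sat {A} {w} {X} f l = mk⇔ (elim l) (intro l)
    where
    elim : ∀ l → sat M w X (⋀ (map f l)) → ∀ x → x ∈ l → sat M w X (f x)
    elim (y ∷ l) (fy , _) x (here refl) = fy
    elim (y ∷ l) (_ , rest) x (there x∈) = elim l rest x x∈
    intro : ∀ l → (∀ x → x ∈ l → sat M w X (f x)) → sat M w X (⋀ (map f l))
    intro [] h = λ ()
    intro (y ∷ l) h = h y (here refl) , intro l (λ x x∈ → h x (there x∈))

  ⋁-sat : ∀ {A : Set} {w X} (f : A → Fm) (l : List A) →
    sat M w X (⋁ (map f l)) ⇔ Σ A (λ x → x ∈ l × sat M w X (f x))
  ⋁-sat {A} {w} {X} f l = mk⇔ (elim l) (λ (x , x∈ , fx) → intro l x∈ fx)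
    where
    elim : ∀ l → sat M w X (⋁ (map f l)) → Σ A (λ x → x ∈ l × sat M w X (f x))
    elim (y ∷ l) (inj₁ fy) = y , here refl , fy
    elim (y ∷ l) (inj₂ rest) with elim l rest
    ... | x , x∈ , fx = x , there x∈ , fx
    intro : ∀ l {x} → x ∈ l → sat M w X (f x) → sat M w X (⋁ (map f l))
    intro (y ∷ l) (here refl) fx = inj₁ fx
    intro (y ∷ l) (there x∈) fx = inj₂ (intro l x∈ fx)

  ⋀-map-mono : ∀ {A : Set} {v v′ X Y} (f g : A → Fm) (l : List A) →
    (∀ x → x ∈ l → sat M v X (f x) → sat M v′ Y (g x)) →
    sat M v X (⋀ (map f l)) → sat M v′ Y (⋀ (map g l))
  ⋀-map-mono f g l h s = from (⋀-sat g l) (λ x x∈ → h x x∈ (to (⋀-sat f l) s x x∈))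

  ⋀∈-sat : ∀ {n w X} (K : Subset n) (f : Fin n → Fm) →
    sat M w X (⋀∈ K f) ⇔ (∀ k → k ∈ₛ K → sat M w X (f k))
  ⋀∈-sat K f = mk⇔
    (λ s k k∈K → to (⋀-sat f (elems K)) s k (from (∈-elems K) k∈K))
    (λ h → from (⋀-sat f (elems K)) (λ k k∈ → h k (to (∈-elems K) k∈)))

  ⋁∈-sat : ∀ {n w X} (K : Subset n) (f : Fin n → Fm) →
    sat M w X (⋁∈ K f) ⇔ Σ (Fin n) (λ k → k ∈ₛ K × sat M w X (f k))
  ⋁∈-sat K f = mk⇔
    (λ s → let (k , k∈ , fk) = to (⋁-sat f (elems K)) s in k , to (∈-elems K) k∈ , fk)
    (λ (k , k∈K , fk) → from (⋁-sat f (elems K)) (k , from (∈-elems K) k∈K , fk))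

  ⋀⊆-sat : ∀ {n w X} (f : Subset n → Fm) →
    sat M w X (⋀⊆ n f) ⇔ (∀ K → sat M w X (f K))
  ⋀⊆-sat {n} f = mk⇔
    (λ s K → to (⋀-sat f (allSubsets n)) s K (∈-allSubsets K))
    (λ h → from (⋀-sat f (allSubsets n)) (λ K _ → h K))

  dnf-sat : ∀ {n w X} (θ : Fin n → Disj) →
    sat M w X (dnf θ) ⇔ Σ (Fin n) (λ i → sat M w X (disjFm (θ i)))
  dnf-sat {w = w} {X = X} θ = mk⇔ (elim θ) (λ (i , s) → intro θ i s)
    where
    elim : ∀ {n} (θ : Fin n → Disj) → sat M w X (dnf θ) → Σ (Fin n) (λ i → sat M w X (disjFm (θ i)))
    elim {suc n} θ (inj₁ s) = zero , s
    elim {suc n} θ (inj₂ s) with elim (θ ∘ suc) s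
    ... | i , t = suc i , t
    intro : ∀ {n} (θ : Fin n → Disj) i → sat M w X (disjFm (θ i)) → sat M w X (dnf θ)
    intro θ zero s = inj₁ s
    intro θ (suc i) s = inj₂ (intro (θ ∘ suc) i s)

  nonmodal-indep : ∀ {φ v} → NonModal φ → ∀ {X Y} → sat M v X φ → sat M v Y φ
  nonmodal-indep (nm-atom p) s = s
  nonmodal-indep nm-⊥ s = s
  nonmodal-indep (nm-¬ a) s = λ t → s (nonmodal-indep a t)
  nonmodal-indep (nm-∧ a b) (s , t) = nonmodal-indep a s , nonmodal-indep b t
  nonmodal-indep (nm-∨ a b) (inj₁ s) = inj₁ (nonmodal-indep a s)
  nonmodal-indep (nm-∨ a b) (inj₂ s) = inj₂ (nonmodal-indep b s)
  nonmodal-indep (nm-→ a b) s = λ t → nonmodal-indep b (s (nonmodal-indep a t))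

  sat-ext : ∀ {X Y} → X ⊑ Y → Y ⊑ X → ∀ {v} φ → sat M v X φ → sat M v Y φ
  sat-ext X⊑Y Y⊑X (atom p) s = s
  sat-ext X⊑Y Y⊑X ⊥′ s = s
  sat-ext X⊑Y Y⊑X (¬′ φ) s = λ t → s (sat-ext Y⊑X X⊑Y φ t)
  sat-ext X⊑Y Y⊑X (φ ∧′ ψ) (s , t) = sat-ext X⊑Y Y⊑X φ s , sat-ext X⊑Y Y⊑X ψ t
  sat-ext X⊑Y Y⊑X (φ ∨′ ψ) (inj₁ s) = inj₁ (sat-ext X⊑Y Y⊑X φ s)
  sat-ext X⊑Y Y⊑X (φ ∨′ ψ) (inj₂ s) = inj₂ (sat-ext X⊑Y Y⊑X ψ s)
  sat-ext X⊑Y Y⊑X (φ →′ ψ) s = λ t → sat-ext X⊑Y Y⊑X ψ (s (sat-ext Y⊑X X⊑Y φ t))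
  sat-ext X⊑Y Y⊑X (□ φ) s = λ u Yu → sat-ext X⊑Y Y⊑X φ (s u (Y⊑X u Yu))

  -- Y ⊨ ◇ γ, which does not depend on the world (just as Y ⊨ □ γ is
  -- Supports M Y γ); stating the modal lemmas this way keeps them world-free.
  Possible : State M → Fm → Set
  Possible Y γ = ¬ Supports M Y (¬′ γ)

  ◇-mono : ∀ {γ Y Z} → NonModal γ → Y ⊑ Z → Possible Y γ → Possible Z γ
  ◇-mono nγ Y⊑Z ◇γ none = ◇γ (λ u Yu γu → none u (Y⊑Z u Yu) (nonmodal-indep nγ γu))

  modalPart-indep : ∀ {v w Y} d → sat M v Y (modalPart d) → sat M w Y (modalPart d)
  modalPart-indep d (□β , ◇γs) = □β , ⋀-map-mono ◇_ ◇_ (dias d) (λ _ _ ◇γ → ◇γ) ◇γs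

  _∣_ : State M → Fm → State M
  (X ∣ φ) v = X v × sat M v X φ

  □→-⊑ : ∀ {X} φ ψ → Supports M X (φ →′ ψ) ⇔ (X ∣ φ) ⊑ (X ∣ ψ)
  □→-⊑ φ ψ = mk⇔ (λ h v (Xv , φv) → Xv , h v Xv φv) (λ s u Xu φu → proj₂ (s u (Xu , φu)))

  ◇-strict : ∀ {X} φ ψ → Possible X (¬′ φ ∧′ ψ) → ¬ ((X ∣ ψ) ⊑ (X ∣ φ))
  ◇-strict φ ψ ◇new ψ⊑φ = ◇new (λ u Xu (¬φu , ψu) → ¬φu (proj₂ (ψ⊑φ u (Xu , ψu))))

  box-restrict : ∀ {β X} φ → NonModal β → Supports M (X ∣ φ) β ⇔ Supports M X (φ →′ β)
  box-restrict φ nβ = mk⇔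
    (λ h u Xu φu → nonmodal-indep nβ (h u (Xu , φu)))
    (λ h u (Xu , φu) → nonmodal-indep nβ (h u Xu φu))

  dia-restrict : ∀ {γ X} φ → NonModal γ → Possible (X ∣ φ) γ ⇔ Possible X (φ ∧′ γ)
  dia-restrict φ nγ = mk⇔
    (λ ◇γ none → ◇γ (λ u (Xu , φu) γu → none u Xu (φu , nonmodal-indep nγ γu)))
    (λ ◇φγ none → ◇φγ (λ u Xu (φu , γu) → none u (Xu , φu) (nonmodal-indep nγ γu)))

  disj-restrict : ∀ {d w X} φ → DisjNonModal d →
    sat M w (X ∣ φ) (disjFm d) ⇔ sat M w X (base d ∧′ relTo φ d)
  disj-restrict {d} φ (nα , nβ , nγs) = mk⇔
    (λ (α , □β , ◇γs) → nonmodal-indep nα α , to (box-restrict φ nβ) □β ,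
       ⋀-map-mono ◇_ _ (dias d) (λ γ γ∈ → to (dia-restrict φ (nγs γ γ∈))) ◇γs)
    (λ (α , □β , ◇γs) → nonmodal-indep nα α , from (box-restrict φ nβ) □β ,
       ⋀-map-mono _ ◇_ (dias d) (λ γ γ∈ → from (dia-restrict φ (nγs γ γ∈))) ◇γs)

  -- Quantifying over all complete state descriptions S amounts to looking
  -- at the one actually realised at v.
  by-state : ExcludedMiddle 0ℓ → ∀ {n v X} (a H : Fin n → Fm) →
    sat M v X (⋀⊆ n (λ S → stateFm a S →′ ⋁∈ S H)) ⇔
    Σ (Fin n) (λ j → sat M v X (a j) × sat M v X (H j))
  by-state em {n} {v} {X} a H = mk⇔ realised (λ (j , aj , Hj) → every aj Hj)
    where
    A? : ∀ j → Dec (sat M v X (a j))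
    A? j = em
    realised : sat M v X (⋀⊆ n (λ S → stateFm a S →′ ⋁∈ S H)) →
      Σ (Fin n) (λ j → sat M v X (a j) × sat M v X (H j))
    realised h with to (⋁∈-sat (select A?) H) (to (⋀⊆-sat _) h (select A?) described)
      where
      described : sat M v X (stateFm a (select A?))
      described = from (⋀∈-sat (select A?) a) (λ j j∈ → to (∈-select A? j) j∈)
                , from (⋀∈-sat (∁ (select A?)) _)
                    (λ j j∈ aj → x∈∁p⇒x∉p j∈ (from (∈-select A? j) aj))
    ... | j , j∈ , Hj = j , to (∈-select A? j) j∈ , Hj
    every : ∀ {j} → sat M v X (a j) → sat M v X (H j) →
      sat M v X (⋀⊆ n (λ S → stateFm a S →′ ⋁∈ S H))
    every {j} aj Hj = from (⋀⊆-sat (λ S → stateFm a S →′ ⋁∈ S H)) λ S (inS , outS) → case S inS outS (j ∈? S)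
      where
      case : ∀ S → sat M v X (⋀∈ S a) → sat M v X (⋀∈ (∁ S) (λ s → ¬′ a s)) →
        Dec (j ∈ₛ S) → sat M v X (⋁∈ S H)
      case S _ _ (yes j∈S) = from (⋁∈-sat S H) (j , j∈S , Hj)
      case S _ outS (no j∉S) = ⊥-elim (to (⋀∈-sat (∁ S) _) outS j (x∉p⇒x∈∁p j∉S) aj)

module KM (em : ExcludedMiddle 0ℓ) {nI nJ : ℕ} (θ : Fin nI → Disj) (ω : Fin nJ → Disj)
  (nθ : ∀ i → DisjNonModal (θ i)) (nω : ∀ j → DisjNonModal (ω j))
  (M : Model) (w : W M) (X : State M) where

  open Semantics M
  open Translation θ ω

  X[_] : Subset nI → State M
  X[ K ] = X ∣ info K

  profile : State M → Subset nI
  profile Y = select {P = λ i → sat M w Y (modalPart (θ i))} (λ _ → em)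

  ∈-profile : ∀ Y i → i ∈ₛ profile Y ⇔ sat M w Y (modalPart (θ i))
  ∈-profile Y = ∈-select (λ _ → em)

  good⇒supports : ∀ K → sat M w X (good K) → Supports M X[ K ] (dnf θ)
  good⇒supports K gK v (Xv , (bases , _)) with to (⋁∈-sat K _) bases
  ... | k , k∈K , αk = from (dnf-sat θ) (k , from (disj-restrict (info K) (nθ k)) (αk , boxes , diamonds))
    where
    boxes : sat M v X (□ (info K →′ box (θ k)))
    boxes u _ (_ , βs) = to (⋀∈-sat K _) βs k k∈K
    diamonds : sat M v X (⋀ (map (λ χ → ◇ (info K ∧′ χ)) (dias (θ k))))
    diamonds = ⋀-map-mono _ _ (dias (θ k)) (λ _ _ ◇χ → ◇χ) (to (⋀∈-sat K _) gK k k∈K)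

  supports⇒⊑ : ∀ {Y} → Y ⊑ X → Supports M Y (dnf θ) → Y ⊑ X[ profile Y ]
  supports⇒⊑ {Y} Y⊑X sY v Yv with to (dnf-sat θ) (sY v Yv)
  ... | i , αi , modal-i = Y⊑X v Yv , (base-i , boxes)
    where
    base-i : sat M v X (⋁∈ (profile Y) (λ k → base (θ k)))
    base-i = from (⋁∈-sat (profile Y) _)
      (i , from (∈-profile Y i) (modalPart-indep (θ i) modal-i) , nonmodal-indep (proj₁ (nθ i)) αi)
    boxes : sat M v X (⋀∈ (profile Y) (λ k → box (θ k)))
    boxes = from (⋀∈-sat (profile Y) _) λ k k∈ →
      nonmodal-indep (proj₁ (proj₂ (nθ k))) (proj₁ (to (∈-profile Y k) k∈) v Yv)

  supports⇒good : ∀ {Y} → Y ⊑ X → Supports M Y (dnf θ) → sat M w X (good (profile Y))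
  supports⇒good {Y} Y⊑X sY = from (⋀∈-sat (profile Y) _) λ k k∈ →
    ⋀-map-mono ◇_ _ (dias (θ k))
      (λ χ χ∈ ◇χ → to (dia-restrict (info (profile Y)) (proj₂ (proj₂ (nθ k)) χ χ∈))
                      (◇-mono (proj₂ (proj₂ (nθ k)) χ χ∈) (supports⇒⊑ Y⊑X sY) ◇χ))
      (proj₂ (to (∈-profile Y k) k∈))

  max⇒maximal : ∀ K → sat M w X (max K) → MaximalFor M X (dnf θ) X[ K ]
  max⇒maximal K (gK , noLarger) = (λ _ → proj₁) , good⇒supports K gK , maximality
    where
    maximality : ∀ Y → Y ⊑ X → Supports M Y (dnf θ) → X[ K ] ⊑ Y → Y ⊑ X[ K ]
    maximality Y Y⊑X sY K⊑Y u Yu with em {sat M u X (info K)}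
    ... | yes iKu = Y⊑X u Yu , iKu
    ... | no ¬iKu = ⊥-elim (to (⋀⊆-sat _) noLarger (profile Y) (K⊑L , escapes) (supports⇒good Y⊑X sY))
      where
      K⊑L : sat M w X (□ (info K →′ info (profile Y)))
      K⊑L = from (□→-⊑ (info K) (info (profile Y))) (⊑-trans K⊑Y (supports⇒⊑ Y⊑X sY))
      escapes : sat M w X (◇ (¬′ info K ∧′ info (profile Y)))
      escapes none = none u (Y⊑X u Yu) (¬iKu , proj₂ (supports⇒⊑ Y⊑X sY u Yu))

  maximal⇒⊒ : ∀ {X′} → MaximalFor M X (dnf θ) X′ → X[ profile X′ ] ⊑ X′
  maximal⇒⊒ (X′⊑X , sX′ , maxX′) =
    maxX′ _ (λ _ → proj₁) (good⇒supports (profile _) (supports⇒good X′⊑X sX′)) (supports⇒⊑ X′⊑X sX′)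

  maximal⇒max : ∀ {X′} → MaximalFor M X (dnf θ) X′ → sat M w X (max (profile X′))
  maximal⇒max {X′} (X′⊑X , sX′ , maxX′) = supports⇒good X′⊑X sX′ , from (⋀⊆-sat _) noLarger
    where
    K = profile X′
    noLarger : ∀ L → sat M w X ((□ (info K →′ info L) ∧′ ◇ (¬′ info K ∧′ info L)) →′ ¬′ good L)
    noLarger L (K⊑L , escapes) gL = ◇-strict (info K) (info L) escapes
      (⊑-trans (maxX′ X[ L ] (λ _ → proj₁) (good⇒supports L gL)
                 (⊑-trans (supports⇒⊑ X′⊑X sX′) (to (□→-⊑ (info K) (info L)) K⊑L)))
               (supports⇒⊑ X′⊑X sX′))

  □Ω-restrict : ∀ {φ} → sat M w (X ∣ φ) (□ (dnf ω)) ⇔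
    sat M w X (□ (φ →′ ⋀⊆ nJ (λ S → stateFm (base ∘ ω) S →′ ⋁∈ S (relTo φ ∘ ω))))
  □Ω-restrict {φ} = mk⇔
    (λ h v Xv φv → to Ω-restrict (h v (Xv , φv)))
    (λ h v (Xv , φv) → from Ω-restrict (h v Xv φv))
    where
    Ω-restrict : ∀ {v} → sat M v (X ∣ φ) (dnf ω) ⇔
      sat M v X (⋀⊆ nJ (λ S → stateFm (base ∘ ω) S →′ ⋁∈ S (relTo φ ∘ ω)))
    Ω-restrict = mk⇔
      (λ s → let (j , ωj) = to (dnf-sat ω) s in
             from (by-state em _ _) (j , to (disj-restrict φ (nω j)) ωj))
      (λ s → let (j , αj , rj) = to (by-state em _ _) s in
             from (dnf-sat ω) (j , from (disj-restrict φ (nω j)) (αj , rj)))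

proposition2 : ExcludedMiddle 0ℓ → ExcludedMiddle (Level.suc 0ℓ) →
    ∀ {nI nJ : ℕ} (θ : Fin nI → Disj) (ω : Fin nJ → Disj) →
    (∀ i → DisjNonModal (θ i)) → (∀ j → DisjNonModal (ω j)) →
    ∀ (M : Model) (w : W M) (X : State M) →
    satKM M w X (dnf θ) (dnf ω) ⇔ sat M w X (lamStar θ ω)
proposition2 em _ θ ω nθ nω M w X = mk⇔ forward backward
  where
  open Semantics M
  open KM em θ ω nθ nω M w X

  -- each max_K yields the maximal state X[K], at which □Ω holds
  forward : satKM M w X (dnf θ) (dnf ω) → sat M w X (lamStar θ ω)
  forward km = from (⋀⊆-sat _) λ K maxK → to □Ω-restrict (km X[ K ] (max⇒maximal K maxK))

  -- each maximal X′ coincides with X[K] for its profile K, which satisfies max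
  backward : sat M w X (lamStar θ ω) → satKM M w X (dnf θ) (dnf ω)
  backward λ* X′ mx@(X′⊑X , sX′ , _) =
    sat-ext (maximal⇒⊒ mx) (supports⇒⊑ X′⊑X sX′) {w} (□ (dnf ω))
      (from □Ω-restrict (to (⋀⊆-sat _) λ* (profile X′) (maximal⇒max mx)))
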